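{- For every sequent $S$: if $S$ is provable in $\mathsf{G}^\infty_{\mathrm{slim}}$, then $S$ has a cyclic proof in $\mathsf{G}^\infty$.
   Context: Formulas: $\phi ::= p \mid \bot \mid \phi\to\phi \mid \phi\rhd\phi$. A sequent $\Gamma\Rightarrow\Delta$ is a pair of finite multisets of formulas; commas denote multiset union; $\Sigma\rhd\bot := \{\sigma\rhd\bot:\sigma\in\Sigma\}$; for formulas $\phi_0,\dots,\phi_{m-1}$, $\Phi_{[0,i)} := \{\phi_0,\dots,\phi_{i-1}\}$. Rules: (ax) $p,\Gamma\Rightarrow p,\Delta$ for a variable $p$; ($\bot$L) $\bot,\Gamma\Rightarrow\Delta$; ($\bot$R) from $\Gamma\Rightarrow\Delta$ infer $\Gamma\Rightarrow\bot,\Delta$; ($\to$L) from $\Gamma\Rightarrow\Delta,\phi$ and $\psi,\Gamma\Rightarrow\Delta$ infer $\phi\to\psi,\Gamma\Rightarrow\Delta$; ($\to$R) from $\phi,\Gamma\Rightarrow\Delta,\psi$ infer $\Gamma\Rightarrow\Delta,\phi\to\psi$; ($\rhd_{\mathsf{IK4}}$) for $m\ge0$: from the premises $\psi_i,(\Phi_{[0,i)},\phi)\rhd\bot\Rightarrow\Phi_{[0,i)},\phi$ ($i=0,\dots,m$) infer $\phi_0\rhd\psi_0,\dots,\phi_{m-1}\rhd\psi_{m-1},\Gamma\Rightarrow\psi_m\rhd\phi,\Delta$; ($\rhd^{\mathrm{slim}}_{\mathsf{IK4}}$) the instances of $\rhd_{\mathsf{IK4}}$ in which $\phi_0,\dots,\phi_{m-1}$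 are pairwise distinct. $\mathsf{G}^\infty_{\mathrm{slim}}$: a proof is a possibly infinite, finitely branching tree whose nodes are labelled with sequents and rules among ax, $\bot$L, $\bot$R, $\to$L, $\to$R, $\rhd^{\mathrm{slim}}_{\mathsf{IK4}}$, each node with its children being an instance of its rule (leaves are ax or $\bot$L), such that every infinite branch passes infinitely often from the conclusion of a $\rhd^{\mathrm{slim}}_{\mathsf{IK4}}$ instance to one of its premises. A cyclic proof in $\mathsf{G}^\infty$ is a finite tree whose nodes are labelled with sequents, where some leaves are marked "Repeat", all other nodes are labelled with a rule among ax, $\bot$L, $\bot$R, $\to$L, $\to$R, $\rhd_{\mathsf{IK4}}$ and form with their children an instance of that rule, together with a map assigning to each Repeat leaf $w$ a node $w^\circ$ strictly below $w$ carrying the same sequent, such that for each Repeat leaf $w$ the path from $w^\circ$ to $w$ contains a step from the conclusion of a $\rhd_{\mathsf{IK4}}$ instance to one of its premises. -}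

module Defs where

open import Data.Nat using (ℕ; _≤_)
open import Data.Bool using (Bool; true; false; _∨_)
open import Data.Product using (Σ; ∃; _×_; _,_; proj₁; uncurry)
open import Data.Unit using (⊤)
open import Data.List using (List; []; _∷_; _++_; [_]; map)
open import Data.List.Membership.Propositional using (_∈_)
open import Data.List.Relation.Unary.All using (All)
open import Data.List.Relation.Unary.Unique.Propositional using (Unique)
open import Data.List.Relation.Binary.Pointwise using (Pointwise)
open import Data.List.Relation.Binary.Permutation.Propositional using (_↭_)
open import Relation.Binary.PropositionalEquality using (_≡_)

infixr 6 _⊃_
infixr 7 _▷_
data Fm : Set where
  var : ℕ → Fm
  bot : Fm
  _⊃_ : Fm → Fm → Fm
  _▷_ : Fm → Fm → Fm

-- Sequents: pairs of finite multisets, represented by lists; multiset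
-- equality is _↭_ (permutation).  All rules are stated up to _↭_.

infix 4 _⇒_
record Sequent : Set where
  constructor _⇒_
  field
    ante : List Fm
    succ : List Fm
open Sequent public

_≈S_ : Sequent → Sequent → Set
(Γ ⇒ Δ) ≈S (Γ' ⇒ Δ') = (Γ ↭ Γ') × (Δ ↭ Δ')

_▷⊥ : List Fm → List Fm
Σs ▷⊥ = map (λ σ → σ ▷ bot) Σs

rhdPremise : List Fm → Fm → Fm → Sequent
rhdPremise Φ ψ φ = (ψ ∷ ((Φ ++ [ φ ]) ▷⊥)) ⇒ (Φ ++ [ φ ])

-- the premises i = 0..m of the ▷_IK4 rule, for principal formulas
-- ps = [(φ₀,ψ₀),…,(φ_{m-1},ψ_{m-1})], ψm = ψ_m and the diagonal φ;
-- acc holds Φ_[0,i)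
rhdPremisesFrom : List Fm → List (Fm × Fm) → Fm → Fm → List Sequent
rhdPremisesFrom acc []              ψm φ = [ rhdPremise acc ψm φ ]
rhdPremisesFrom acc ((φi , ψi) ∷ ps) ψm φ =
  rhdPremise acc ψi φ ∷ rhdPremisesFrom (acc ++ [ φi ]) ps ψm φ

rhdPremises : List (Fm × Fm) → Fm → Fm → List Sequent
rhdPremises = rhdPremisesFrom []

data Inst : Sequent → List Sequent → Set where
  ax   : ∀ {Γ Δ Γ' Δ'} (p : ℕ) → Γ ↭ (var p ∷ Γ') → Δ ↭ (var p ∷ Δ') →
         Inst (Γ ⇒ Δ) []
  botL : ∀ {Γ Δ Γ'} → Γ ↭ (bot ∷ Γ') → Inst (Γ ⇒ Δ) []
  botR : ∀ {Γ Δ Δ'} → Δ ↭ (bot ∷ Δ') → Inst (Γ ⇒ Δ) [ Γ ⇒ Δ' ]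
  impL : ∀ {Γ Δ Γ'} (φ ψ : Fm) → Γ ↭ ((φ ⊃ ψ) ∷ Γ') →
         Inst (Γ ⇒ Δ) ((Γ' ⇒ (Δ ++ [ φ ])) ∷ ((ψ ∷ Γ') ⇒ Δ) ∷ [])
  impR : ∀ {Γ Δ Δ'} (φ ψ : Fm) → Δ ↭ ((φ ⊃ ψ) ∷ Δ') →
         Inst (Γ ⇒ Δ) [ (φ ∷ Γ) ⇒ (Δ' ++ [ ψ ]) ]
  rhd  : ∀ {Γ Δ Γ' Δ'} (ps : List (Fm × Fm)) (ψm φ : Fm) →
         Γ ↭ (map (uncurry _▷_) ps ++ Γ') → Δ ↭ ((ψm ▷ φ) ∷ Δ') →
         Inst (Γ ⇒ Δ) (rhdPremises ps ψm φ)

isRhd : ∀ {S Ps} → Inst S Ps → Bool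
isRhd (rhd _ _ _ _ _) = true
isRhd _               = false

Slim : ∀ {S Ps} → Inst S Ps → Set
Slim (rhd ps _ _ _ _) = Unique (map proj₁ ps)
Slim _                = ⊤

-- A possibly infinite, finitely branching tree is
-- presented as (the unfolding from a root of) a coalgebra: a type of
-- nodes, each with a sequent, a rule instance, and a finite list of
-- children whose sequents are exactly the premises of the instance.

record SlimProof (S : Sequent) : Set₁ where
  field
    Node     : Set
    root     : Node
    seq      : Node → Sequent
    prems    : Node → List Sequent
    rule     : (x : Node) → Inst (seq x) (prems x)
    slim     : (x : Node) → Slim (rule x)
    children : Node → List Node
    childOk  : (x : Node) → Pointwise (λ y P → seq y ≡ P) (children x) (prems x)
    rootOk   : seq root ≡ S
    progress : (f : ℕ → Node) → f 0 ≡ root →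
               (∀ n → f (ℕ.suc n) ∈ children (f n)) →
               ∀ n → ∃ λ k → n ≤ k × isRhd (rule (f k)) ≡ true

-- CTree anc S is a finite tree with root S; anc
-- lists the ancestors of the root (nearest first), each with a flag
-- recording whether the path from that ancestor to the current node
-- contains a step from the conclusion of a ▷_IK4 instance to a premise.
-- A Repeat leaf points to an ancestor carrying the same sequent whose
-- flag is true.

mark : Bool → List (Sequent × Bool) → List (Sequent × Bool)
mark b = map (λ { (x , c) → (x , c ∨ b) })

data CTree (anc : List (Sequent × Bool)) : Sequent → Set where
  repeat : ∀ {S S'} → (S' , true) ∈ anc → S ≈S S' → CTree anc S
  node   : ∀ {S Ps} (r : Inst S Ps) →
           All (CTree (mark (isRhd r) ((S , false) ∷ anc))) Ps →
           CTree anc S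

CyclicProof : Sequent → Set
CyclicProof S = CTree [] S

-- Every sequent of a slim proof of S is built from the finite set L of subformulas of S,
-- ⊥, and the formulas σ ▷ ⊥ for such σ.  Weighing ▷-formulas as atoms, the non-modal
-- rules strictly decrease the weight of a sequent, and the premises of a slim ▷ rule have
-- weight bounded in terms of L alone, because φ₀ … φ_{m-1} are distinct elements of L.
-- So only finitely many sequents occur.  Unfold the proof from the root and close a
-- branch by Repeat as soon as its sequent already occurs below it with a ▷ step in
-- between.  This terminates: a ▷ step turns its own conclusion into such a repeatable
-- sequent, which can happen only finitely often, and between ▷ steps the weight drops.
-- The progress condition on infinite branches is not needed.
module Submission where

open import Defs
open import Data.Nat using (ℕ; zero; suc; _+_; _≤_; _<_; z≤n; s≤s)
import Data.Nat as ℕ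
open import Data.Nat.Properties
open import Data.Nat.ListAction using (sum)
open import Data.Nat.ListAction.Properties using (sum-++; sum-↭)
open import Data.Nat.Tactic.RingSolver using (solve-∀)
open import Data.Bool using (Bool; true; false)
import Data.Bool as Bool
open import Data.Product using (_×_; _,_; proj₁; proj₂; uncurry)
import Data.Product as Product
import Data.Product.Properties as Productₚ
open import Data.Sum using (inj₁; inj₂)
open import Data.List using (List; []; _∷_; _++_; [_]; map; length; filter; concatMap; cartesianProductWith)
open import Data.List.Properties using (++-assoc; ++-identityʳ; map-++; ≡-dec)
open import Data.List.Membership.Propositional using (_∈_)
open import Data.List.Membership.Propositional.Properties
  using (∈-map⁺; ∈-map⁻; ∈-++⁺ˡ; ∈-++⁺ʳ; ∈-++⁻; ∈-∃++; ∈-concatMap⁺; ∈-concatMap⁻; ∈-cartesianProductWith⁺)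
open import Data.List.Relation.Unary.Any using (here; there)
import Data.List.Relation.Unary.Any as Any
open import Data.List.Relation.Unary.All using (All; []; _∷_)
import Data.List.Relation.Unary.All as All
import Data.List.Relation.Unary.All.Properties as All
open import Data.List.Relation.Unary.AllPairs using ([]; _∷_)
open import Data.List.Relation.Unary.Unique.Propositional using (Unique)
open import Data.List.Relation.Binary.Pointwise using (Pointwise; []; _∷_)
open import Data.List.Relation.Binary.Permutation.Propositional using (_↭_; ↭-refl; ↭-sym)
open import Data.List.Relation.Binary.Permutation.Propositional.Properties using (All-resp-↭; ∈-resp-↭; shift; map⁺)
open import Relation.Binary.Definitions using (DecidableEquality)
open import Relation.Binary.PropositionalEquality using (_≡_; _≢_; refl; sym; cong; subst)
open import Relation.Nullary using (¬_; yes; no; contradiction)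
open import Relation.Nullary.Decidable using (map′; _×-dec_)
open import Relation.Unary using (Pred; Decidable)
open import Function using (_∘_)

var-injective : ∀ {p q} → var p ≡ var q → p ≡ q
var-injective refl = refl

infix 4 _≟ᶠ_ _≟ˢ_

_≟ᶠ_ : DecidableEquality Fm
var p   ≟ᶠ var q   = map′ (cong var) var-injective (p ℕ.≟ q)
bot     ≟ᶠ bot     = yes refl
(a ⊃ b) ≟ᶠ (c ⊃ d) = map′ (λ { (refl , refl) → refl }) (λ { refl → refl , refl }) (a ≟ᶠ c ×-dec b ≟ᶠ d)
(a ▷ b) ≟ᶠ (c ▷ d) = map′ (λ { (refl , refl) → refl }) (λ { refl → refl , refl }) (a ≟ᶠ c ×-dec b ≟ᶠ d)
var _   ≟ᶠ bot     = no λ ()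
var _   ≟ᶠ _ ⊃ _   = no λ ()
var _   ≟ᶠ _ ▷ _   = no λ ()
bot     ≟ᶠ var _   = no λ ()
bot     ≟ᶠ _ ⊃ _   = no λ ()
bot     ≟ᶠ _ ▷ _   = no λ ()
_ ⊃ _   ≟ᶠ var _   = no λ ()
_ ⊃ _   ≟ᶠ bot     = no λ ()
_ ⊃ _   ≟ᶠ _ ▷ _   = no λ ()
_ ▷ _   ≟ᶠ var _   = no λ ()
_ ▷ _   ≟ᶠ bot     = no λ ()
_ ▷ _   ≟ᶠ _ ⊃ _   = no λ ()

_≟ˢ_ : DecidableEquality Sequent
(Γ ⇒ Δ) ≟ˢ (Γ' ⇒ Δ') =
  map′ (λ { (refl , refl) → refl }) (λ { refl → refl , refl }) (≡-dec _≟ᶠ_ Γ Γ' ×-dec ≡-dec _≟ᶠ_ Δ Δ')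

open import Data.List.Membership.DecPropositional (Productₚ.≡-dec _≟ˢ_ Bool._≟_) using (_∈?_; _∉?_)

module _ {a} {A : Set a} where

  listsUpTo : List A → ℕ → List (List A)
  listsUpTo L zero    = [ [] ]
  listsUpTo L (suc n) = [] ∷ cartesianProductWith _∷_ L (listsUpTo L n)

  ∈-listsUpTo : ∀ {L xs} n → All (_∈ L) xs → length xs ≤ n → xs ∈ listsUpTo L n
  ∈-listsUpTo zero    []           _            = here refl
  ∈-listsUpTo (suc n) []           _            = here refl
  ∈-listsUpTo (suc n) (x∈L ∷ xs⊆L) (s≤s |xs|≤n) =
    there (∈-cartesianProductWith⁺ _∷_ x∈L (∈-listsUpTo n xs⊆L |xs|≤n))

  Unique-++⁻ˡ : ∀ xs {ys : List A} → Unique (xs ++ ys) → Unique xs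
  Unique-++⁻ˡ []       _             = []
  Unique-++⁻ˡ (x ∷ xs) (x∉xs++ys ∷ u) = All.++⁻ˡ xs x∉xs++ys ∷ Unique-++⁻ˡ xs u

  ∈⇒≤sum-map : ∀ (f : A → ℕ) {x xs} → x ∈ xs → f x ≤ sum (map f xs)
  ∈⇒≤sum-map f             (here refl) = m≤m+n (f _) _
  ∈⇒≤sum-map f {xs = y ∷ _} (there x∈) = ≤-trans (∈⇒≤sum-map f x∈) (m≤n+m _ (f y))

  sum-map-mono-Unique : ∀ (f : A → ℕ) {xs ys} → Unique xs → All (_∈ ys) xs →
                        sum (map f xs) ≤ sum (map f ys)
  sum-map-mono-Unique f [] [] = z≤n
  sum-map-mono-Unique f {x ∷ xs} (x∉xs ∷ u) (x∈ys ∷ xs⊆ys)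
    with as , bs , refl ← ∈-∃++ x∈ys = begin
      f x + sum (map f xs)        ≤⟨ +-monoʳ-≤ (f x) (sum-map-mono-Unique f u xs⊆as++bs) ⟩
      sum (map f (x ∷ as ++ bs))  ≡⟨ sum-↭ (map⁺ f (↭-sym (shift x as bs))) ⟩
      sum (map f (as ++ x ∷ bs))  ∎
    where
    open ≤-Reasoning
    drop-x : ∀ {y} → x ≢ y × y ∈ as ++ x ∷ bs → y ∈ as ++ bs
    drop-x (x≢y , y∈) with ∈-resp-↭ (shift x as bs) y∈
    ... | here y≡x  = contradiction (sym y≡x) x≢y
    ... | there y∈' = y∈'
    xs⊆as++bs : All (_∈ as ++ bs) xs
    xs⊆as++bs = All.zipWith drop-x (x∉xs , xs⊆ys)

  module _ {ℓ₁ ℓ₂} {P : Pred A ℓ₁} {Q : Pred A ℓ₂} (P? : Decidable P) (Q? : Decidable Q)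
           (P⊆Q : ∀ {x} → P x → Q x) where

    length-filter-mono : ∀ xs → length (filter P? xs) ≤ length (filter Q? xs)
    length-filter-mono []       = z≤n
    length-filter-mono (x ∷ xs) with P? x | Q? x
    ... | yes _ | yes _  = s≤s (length-filter-mono xs)
    ... | yes p | no ¬q  = contradiction (P⊆Q p) ¬q
    ... | no _  | yes _  = m≤n⇒m≤1+n (length-filter-mono xs)
    ... | no _  | no _   = length-filter-mono xs

    length-filter-mono-< : ∀ {x xs} → x ∈ xs → ¬ P x → Q x →
                           length (filter P? xs) < length (filter Q? xs)
    length-filter-mono-< {xs = y ∷ ys} x∈xs ¬px qx with P? y | Q? y | x∈xs
    ... | yes p | no ¬q | _         = contradiction (P⊆Q p) ¬q
    ... | yes p | yes _ | here refl = contradiction p ¬px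
    ... | no _  | no ¬q | here refl = contradiction qx ¬q
    ... | no _  | yes _ | here refl = s≤s (length-filter-mono ys)
    ... | yes _ | yes _ | there x∈  = s≤s (length-filter-mono-< x∈ ¬px qx)
    ... | no _  | yes _ | there x∈  = m<n⇒m<1+n (length-filter-mono-< x∈ ¬px qx)
    ... | no _  | no _  | there x∈  = length-filter-mono-< x∈ ¬px qx

subformulas : Fm → List Fm
subformulas (var p) = [ var p ]
subformulas bot     = [ bot ]
subformulas (a ⊃ b) = (a ⊃ b) ∷ subformulas a ++ subformulas b
subformulas (a ▷ b) = (a ▷ b) ∷ subformulas a ++ subformulas b

subformula-refl : ∀ A → A ∈ subformulas A
subformula-refl (var _) = here refl
subformula-refl bot     = here refl
subformula-refl (_ ⊃ _) = here refl
subformula-refl (_ ▷ _) = here refl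

⊃-subformulas : ∀ {a b} → a ∈ subformulas (a ⊃ b) × b ∈ subformulas (a ⊃ b)
⊃-subformulas {a} {b} =
  there (∈-++⁺ˡ (subformula-refl a)) , there (∈-++⁺ʳ (subformulas a) (subformula-refl b))

▷-subformulas : ∀ {a b} → a ∈ subformulas (a ▷ b) × b ∈ subformulas (a ▷ b)
▷-subformulas {a} {b} =
  there (∈-++⁺ˡ (subformula-refl a)) , there (∈-++⁺ʳ (subformulas a) (subformula-refl b))

mutual
  subformula-trans : ∀ {A B C} → A ∈ subformulas B → B ∈ subformulas C → A ∈ subformulas C
  subformula-trans {C = var _} A∈B (here refl) = A∈B
  subformula-trans {C = bot}   A∈B (here refl) = A∈B
  subformula-trans {C = _ ⊃ _} A∈B (here refl) = A∈B
  subformula-trans {C = _ ▷ _} A∈B (here refl) = A∈B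
  subformula-trans {C = c ⊃ d} A∈B (there B∈)  = there (subformula-trans-++ c d A∈B B∈)
  subformula-trans {C = c ▷ d} A∈B (there B∈)  = there (subformula-trans-++ c d A∈B B∈)

  subformula-trans-++ : ∀ {A B} c d → A ∈ subformulas B → B ∈ subformulas c ++ subformulas d →
                        A ∈ subformulas c ++ subformulas d
  subformula-trans-++ c d A∈B B∈ with ∈-++⁻ (subformulas c) B∈
  ... | inj₁ B∈c = ∈-++⁺ˡ (subformula-trans A∈B B∈c)
  ... | inj₂ B∈d = ∈-++⁺ʳ (subformulas c) (subformula-trans A∈B B∈d)

record Closed (L : List Fm) : Set where
  field
    ⊃-closed  : ∀ {a b} → (a ⊃ b) ∈ L → a ∈ L × b ∈ L
    ▷-closed  : ∀ {a b} → (a ▷ b) ∈ L → a ∈ L × b ∈ L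
    ▷⊥-closed : ∀ {a b} → (a ▷ b) ∈ L → (a ▷ bot) ∈ L × (b ▷ bot) ∈ L

subformulasOf : List Fm → List Fm
subformulasOf As = bot ∷ concatMap subformulas As

subformulasOf-closed : ∀ As {A B} → B ∈ subformulasOf As → A ∈ subformulas B → A ∈ subformulasOf As
subformulasOf-closed _ (here refl) (here refl) = here refl
subformulasOf-closed As (there B∈) A∈B =
  there (∈-concatMap⁺ subformulas (Any.map (subformula-trans A∈B) (∈-concatMap⁻ subformulas {As} B∈)))

closure : List Fm → List Fm
closure As = subformulasOf As ++ subformulasOf As ▷⊥

⊆-closure : ∀ {As A} → A ∈ As → A ∈ closure As
⊆-closure A∈ = ∈-++⁺ˡ (there (∈-concatMap⁺ subformulas (Any.map (λ { refl → subformula-refl _ }) A∈)))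

closure-closed : ∀ As → Closed (closure As)
closure-closed As = record
  { ⊃-closed  = λ ab∈ → Product.map ∈-++⁺ˡ ∈-++⁺ˡ (⊃-components ab∈)
  ; ▷-closed  = λ ab∈ → Product.map ∈-++⁺ˡ ∈-++⁺ˡ (▷-components ab∈)
  ; ▷⊥-closed = λ ab∈ → Product.map ▷⊥∈ ▷⊥∈ (▷-components ab∈)
  }
  where
  T : List Fm
  T = subformulasOf As

  ▷⊥∈ : ∀ {a} → a ∈ T → (a ▷ bot) ∈ closure As
  ▷⊥∈ a∈ = ∈-++⁺ʳ T (∈-map⁺ (_▷ bot) a∈)

  ⊃-components : ∀ {a b} → (a ⊃ b) ∈ closure As → a ∈ T × b ∈ T
  ⊃-components ab∈ with ∈-++⁻ T ab∈
  ... | inj₁ ab∈T = Product.map (subformulasOf-closed As ab∈T) (subformulasOf-closed As ab∈T) ⊃-subformulas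
  ... | inj₂ ab∈T▷⊥ with ∈-map⁻ (_▷ bot) ab∈T▷⊥
  ...   | _ , _ , ()

  ▷-components : ∀ {a b} → (a ▷ b) ∈ closure As → a ∈ T × b ∈ T
  ▷-components ab∈ with ∈-++⁻ T ab∈
  ... | inj₁ ab∈T = Product.map (subformulasOf-closed As ab∈T) (subformulasOf-closed As ab∈T) ▷-subformulas
  ... | inj₂ ab∈T▷⊥ with ∈-map⁻ (_▷ bot) ab∈T▷⊥
  ...   | _ , a∈T , refl = a∈T , here refl

wt : Fm → ℕ
wt (var _) = 1
wt bot     = 1
wt (a ⊃ b) = suc (wt a + wt b)
wt (_ ▷ _) = 1

wtL : List Fm → ℕ
wtL Γ = sum (map wt Γ)

wtS : Sequent → ℕ
wtS (Γ ⇒ Δ) = wtL Γ + wtL Δ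

wtL-++ : ∀ Γ Δ → wtL (Γ ++ Δ) ≡ wtL Γ + wtL Δ
wtL-++ Γ Δ rewrite map-++ wt Γ Δ = sum-++ (map wt Γ) (map wt Δ)

wtL-↭ : ∀ {Γ Δ} → Γ ↭ Δ → wtL Γ ≡ wtL Δ
wtL-↭ Γ↭Δ = sum-↭ (map⁺ wt Γ↭Δ)

wtL-▷⊥ : ∀ Γ → wtL (Γ ▷⊥) ≡ length Γ
wtL-▷⊥ []      = refl
wtL-▷⊥ (_ ∷ Γ) = cong suc (wtL-▷⊥ Γ)

wt>0 : ∀ A → 0 < wt A
wt>0 (var _) = s≤s z≤n
wt>0 bot     = s≤s z≤n
wt>0 (_ ⊃ _) = s≤s z≤n
wt>0 (_ ▷ _) = s≤s z≤n

length≤wtL : ∀ Γ → length Γ ≤ wtL Γ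
length≤wtL []      = z≤n
length≤wtL (A ∷ Γ) = +-mono-≤ (wt>0 A) (length≤wtL Γ)

<-from-gap : ∀ {m n} k → n ≡ suc (m + k) → m < n
<-from-gap {m} k refl = s≤s (m≤m+n m k)

module Premises (L : List Fm) (closed : Closed L) where
  open Closed closed

  Over : Sequent → Set
  Over (Γ ⇒ Δ) = All (_∈ L) Γ × All (_∈ L) Δ

  rhdBound : ℕ
  rhdBound = let M = wtL L in M + (M + M) + (M + M)

  WeightBound : Bool → Sequent → Sequent → Set
  WeightBound true  _ P = wtS P ≤ rhdBound
  WeightBound false S P = wtS P < wtS S

  rhdPremise-bounded : ∀ {Φ ψ φ} → All (_∈ L) Φ → All (λ a → (a ▷ bot) ∈ L) Φ → Unique Φ →
                       ψ ∈ L → φ ∈ L → (φ ▷ bot) ∈ L →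
                       Over (rhdPremise Φ ψ φ) × wtS (rhdPremise Φ ψ φ) ≤ rhdBound
  rhdPremise-bounded {Φ} {ψ} {φ} Φ⊆L Φ▷⊥⊆L uΦ ψ∈ φ∈ φ▷⊥∈ =
    (ψ∈ ∷ All.map⁺ (All.++⁺ Φ▷⊥⊆L (φ▷⊥∈ ∷ [])) , All.++⁺ Φ⊆L (φ∈ ∷ [])) , weight
    where
    open ≤-Reasoning
    Ξ : List Fm
    Ξ = Φ ++ [ φ ]
    Ξ-bound : wtL Ξ ≤ wtL L + wtL L
    Ξ-bound = begin
      wtL (Φ ++ [ φ ])   ≡⟨ wtL-++ Φ [ φ ] ⟩
      wtL Φ + wtL [ φ ]  ≤⟨ +-mono-≤ (sum-map-mono-Unique wt uΦ Φ⊆L) (sum-map-mono-Unique wt ([] ∷ []) (φ∈ ∷ [])) ⟩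
      wtL L + wtL L      ∎
    weight : wtS (rhdPremise Φ ψ φ) ≤ rhdBound
    weight = begin
      wt ψ + wtL (Ξ ▷⊥) + wtL Ξ  ≡⟨ cong (λ n → wt ψ + n + wtL Ξ) (wtL-▷⊥ Ξ) ⟩
      wt ψ + length Ξ + wtL Ξ    ≤⟨ +-monoˡ-≤ (wtL Ξ) (+-monoʳ-≤ (wt ψ) (length≤wtL Ξ)) ⟩
      wt ψ + wtL Ξ + wtL Ξ       ≤⟨ +-mono-≤ (+-mono-≤ (∈⇒≤sum-map wt ψ∈) Ξ-bound) Ξ-bound ⟩
      rhdBound                   ∎

  rhdPremisesFrom-bounded : ∀ acc ps {ψm φ} → All (_∈ L) acc → All (λ a → (a ▷ bot) ∈ L) acc →
                            All (λ p → uncurry _▷_ p ∈ L) ps → Unique (acc ++ map proj₁ ps) →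
                            (ψm ▷ φ) ∈ L →
                            All (λ P → Over P × wtS P ≤ rhdBound) (rhdPremisesFrom acc ps ψm φ)
  rhdPremisesFrom-bounded acc [] acc⊆L acc▷⊥⊆L [] u ψm▷φ∈ =
    rhdPremise-bounded acc⊆L acc▷⊥⊆L (subst Unique (++-identityʳ acc) u)
                       (proj₁ (▷-closed ψm▷φ∈)) (proj₂ (▷-closed ψm▷φ∈)) (proj₂ (▷⊥-closed ψm▷φ∈))
    ∷ []
  rhdPremisesFrom-bounded acc ((a , b) ∷ ps) acc⊆L acc▷⊥⊆L (a▷b∈ ∷ ps⊆L) u ψm▷φ∈ =
    rhdPremise-bounded acc⊆L acc▷⊥⊆L (Unique-++⁻ˡ acc u)
                       (proj₂ (▷-closed a▷b∈)) (proj₂ (▷-closed ψm▷φ∈)) (proj₂ (▷⊥-closed ψm▷φ∈))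
    ∷ rhdPremisesFrom-bounded (acc ++ [ a ]) ps
        (All.++⁺ acc⊆L (proj₁ (▷-closed a▷b∈) ∷ [])) (All.++⁺ acc▷⊥⊆L (proj₁ (▷⊥-closed a▷b∈) ∷ []))
        ps⊆L (subst Unique (sym (++-assoc acc [ a ] (map proj₁ ps))) u) ψm▷φ∈

  premises-bounded : ∀ {S Ps} (r : Inst S Ps) → Slim r → Over S →
                     All (λ P → Over P × WeightBound (isRhd r) S P) Ps
  premises-bounded (ax _ _ _) _ _ = []
  premises-bounded (botL _)   _ _ = []
  premises-bounded {Γ ⇒ Δ} (botR {Δ' = Δ'} Δ↭) _ (Γ⊆L , Δ⊆L) with All-resp-↭ Δ↭ Δ⊆L
  ... | _ ∷ Δ'⊆L = ((Γ⊆L , Δ'⊆L) , weight) ∷ []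
    where
    weight : wtS (Γ ⇒ Δ') < wtS (Γ ⇒ Δ)
    weight rewrite wtL-↭ Δ↭ = +-monoʳ-< (wtL Γ) (n<1+n (wtL Δ'))
  premises-bounded {Γ ⇒ Δ} (impL {Γ' = Γ'} φ ψ Γ↭) _ (Γ⊆L , Δ⊆L) with All-resp-↭ Γ↭ Γ⊆L
  ... | φ⊃ψ∈ ∷ Γ'⊆L =
        ((Γ'⊆L , All.++⁺ Δ⊆L (proj₁ (⊃-closed φ⊃ψ∈) ∷ [])) , weight₁)
      ∷ ((proj₂ (⊃-closed φ⊃ψ∈) ∷ Γ'⊆L , Δ⊆L) , weight₂)
      ∷ []
    where
    weight₁ : wtS (Γ' ⇒ (Δ ++ [ φ ])) < wtS (Γ ⇒ Δ)
    weight₁ rewrite wtL-↭ Γ↭ | wtL-++ Δ [ φ ] = <-from-gap (wt ψ) (arith (wtL Γ') (wtL Δ) (wt φ) (wt ψ))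
      where
      arith : ∀ g d p q → suc (p + q) + g + d ≡ suc (g + (d + (p + 0)) + q)
      arith = solve-∀
    weight₂ : wtS ((ψ ∷ Γ') ⇒ Δ) < wtS (Γ ⇒ Δ)
    weight₂ rewrite wtL-↭ Γ↭ = <-from-gap (wt φ) (arith (wtL Γ') (wtL Δ) (wt φ) (wt ψ))
      where
      arith : ∀ g d p q → suc (p + q) + g + d ≡ suc (q + g + d + p)
      arith = solve-∀
  premises-bounded {Γ ⇒ Δ} (impR {Δ' = Δ'} φ ψ Δ↭) _ (Γ⊆L , Δ⊆L) with All-resp-↭ Δ↭ Δ⊆L
  ... | φ⊃ψ∈ ∷ Δ'⊆L =
        ((proj₁ (⊃-closed φ⊃ψ∈) ∷ Γ⊆L , All.++⁺ Δ'⊆L (proj₂ (⊃-closed φ⊃ψ∈) ∷ [])) , weight) ∷ []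
    where
    weight : wtS ((φ ∷ Γ) ⇒ (Δ' ++ [ ψ ])) < wtS (Γ ⇒ Δ)
    weight rewrite wtL-↭ Δ↭ | wtL-++ Δ' [ ψ ] = <-from-gap 0 (arith (wtL Γ) (wtL Δ') (wt φ) (wt ψ))
      where
      arith : ∀ g d p q → g + (suc (p + q) + d) ≡ suc (p + g + (d + (q + 0)) + 0)
      arith = solve-∀
  premises-bounded {Γ ⇒ Δ} (rhd ps ψm φ Γ↭ Δ↭) slim (Γ⊆L , Δ⊆L) with All-resp-↭ Δ↭ Δ⊆L
  ... | ψm▷φ∈ ∷ _ =
    rhdPremisesFrom-bounded [] ps [] [] (All.map⁻ (All.++⁻ˡ (map (uncurry _▷_) ps) (All-resp-↭ Γ↭ Γ⊆L))) slim ψm▷φ∈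

Ancestors : Set
Ancestors = List (Sequent × Bool)

Repeatable : Ancestors → Sequent → Set
Repeatable anc S = (S , true) ∈ anc

Repeatable-mark : ∀ b {S S' anc} → Repeatable anc S' → Repeatable (mark b ((S , false) ∷ anc)) S'
Repeatable-mark b S'∈ = there (∈-map⁺ _ S'∈)

countFresh : List Sequent → Ancestors → ℕ
countFresh cs anc = length (filter (λ S → (S , true) ∉? anc) cs)

countFresh-mark-≤ : ∀ cs b {S anc} → countFresh cs (mark b ((S , false) ∷ anc)) ≤ countFresh cs anc
countFresh-mark-≤ cs b =
  length-filter-mono (λ _ → _ ∉? _) (λ _ → _ ∉? _) (λ S∉ S∈ → S∉ (Repeatable-mark b S∈)) cs

countFresh-mark-< : ∀ {cs S anc} → S ∈ cs → ¬ Repeatable anc S →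
                    countFresh cs (mark true ((S , false) ∷ anc)) < countFresh cs anc
countFresh-mark-< S∈cs ¬rep =
  length-filter-mono-< (λ _ → _ ∉? _) (λ _ → _ ∉? _) (λ S∉ S∈ → S∉ (Repeatable-mark true S∈))
                       S∈cs (λ S∉ → S∉ (here refl)) ¬rep

module Unfolding {S₀ : Sequent} (π : SlimProof S₀) where
  open SlimProof π

  rootFormulas : List Fm
  rootFormulas = ante (seq root) ++ succ (seq root)

  L : List Fm
  L = closure rootFormulas

  open Premises L (closure-closed rootFormulas)

  bound : ℕ
  bound = wtS (seq root) + rhdBound

  Bounded : Sequent → Set
  Bounded S = Over S × wtS S ≤ bound

  candidates : List Sequent
  candidates = cartesianProductWith _⇒_ (listsUpTo L bound) (listsUpTo L bound)

  Bounded⇒∈candidates : ∀ {S} → Bounded S → S ∈ candidates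
  Bounded⇒∈candidates {Γ ⇒ Δ} ((Γ⊆L , Δ⊆L) , w≤) = ∈-cartesianProductWith⁺ _⇒_
    (∈-listsUpTo bound Γ⊆L (≤-trans (length≤wtL Γ) (≤-trans (m≤m+n (wtL Γ) (wtL Δ)) w≤)))
    (∈-listsUpTo bound Δ⊆L (≤-trans (length≤wtL Δ) (≤-trans (m≤n+m (wtL Δ) (wtL Γ)) w≤)))

  root-bounded : Bounded (seq root)
  root-bounded = (All.tabulate (⊆-closure ∘ ∈-++⁺ˡ) , All.tabulate (⊆-closure ∘ ∈-++⁺ʳ (ante (seq root))))
               , m≤m+n (wtS (seq root)) rhdBound

  forChildren : ∀ {ys Ps} {R Q : Sequent → Set} → Pointwise (λ y P → seq y ≡ P) ys Ps →
                All R Ps → (∀ y → R (seq y) → Q (seq y)) → All Q Ps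
  forChildren []             []       f = []
  forChildren (refl ∷ seqOk) (r ∷ rs) f = f _ r ∷ forChildren seqOk rs f

  -- k and w are fuel for the lexicographic measure (countFresh candidates anc, wtS (seq x)).
  mutual
    unfold : ∀ k w x anc → Bounded (seq x) → countFresh candidates anc ≤ k → wtS (seq x) ≤ w →
             CTree anc (seq x)
    unfold k w x anc bx fresh≤k wt≤w with (seq x , true) ∈? anc
    ... | yes rep = repeat rep (↭-refl , ↭-refl)
    ... | no ¬rep = node (rule x)
      (forChildren (childOk x) (premises-bounded (rule x) (slim x) (proj₁ bx))
                   (descend (isRhd (rule x)) k w anc bx ¬rep fresh≤k wt≤w))

    descend : ∀ b k w {S} anc → Bounded S → ¬ Repeatable anc S →
              countFresh candidates anc ≤ k → wtS S ≤ w →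
              ∀ y → Over (seq y) × WeightBound b S (seq y) → CTree (mark b ((S , false) ∷ anc)) (seq y)
    descend true zero _ _ bS ¬rep fresh≤k _ _ _ =
      contradiction (<-≤-trans (countFresh-mark-< (Bounded⇒∈candidates bS) ¬rep) fresh≤k) n≮0
    descend true (suc k) _ _ bS ¬rep fresh≤k _ y (oy , wy≤) =
      unfold k bound y _ by (≤-pred (<-≤-trans (countFresh-mark-< (Bounded⇒∈candidates bS) ¬rep) fresh≤k)) (proj₂ by)
      where
      by : Bounded (seq y)
      by = oy , ≤-trans wy≤ (m≤n+m rhdBound _)
    descend false k zero _ _ _ _ wS≤w _ (_ , wy<wS) = contradiction (<-≤-trans wy<wS wS≤w) n≮0
    descend false k (suc w) _ bS _ fresh≤k wS≤w y (oy , wy<wS) =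
      unfold k w y _ (oy , ≤-trans (<⇒≤ wy<wS) (proj₂ bS))
             (≤-trans (countFresh-mark-≤ candidates false) fresh≤k)
             (≤-pred (<-≤-trans wy<wS wS≤w))

  cyclicProof : CyclicProof S₀
  cyclicProof = subst CyclicProof rootOk
    (unfold (countFresh candidates []) bound root [] root-bounded ≤-refl (proj₂ root-bounded))

mainTheorem10 : (S : Sequent) → SlimProof S → CyclicProof S
mainTheorem10 S π = Unfolding.cyclicProof π
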